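{- Let $k\geq 0$ be an integer, let $n$ and $m$ be nonnegative integers, and let $\epsilon_k$ be an integer with $0\leq \epsilon_k\leq \delta_k(n+m)$. Then the following statements hold: (a) $\partial_k(n)\leq m-\epsilon_k$ if and only if $n\leq \partial^k(n+m)$; (b) $n=\partial^k(n+m)$ if and only if $\partial_k(n)+\delta_k(n+m)=m$; (c) $\partial_k(n)=m$ if and only if $n=\partial^k(n+m)$ and $\delta_k(n+m)=0$.
   Context: For integers $k\geq 1$ and $N\geq 1$ there is a unique expansion $N=\binom{a_k}{k}+\binom{a_{k-1}}{k-1}+\cdots+\binom{a_i}{i}$ with integers $a_k>a_{k-1}>\cdots>a_i\geq i\geq 1$ (the $(k-1)$-dimensional representation of $N$). Using it define $\partial_{k-1}(N)=\sum_{t=i}^{k}\binom{a_t}{t-1}$, $\partial^{k-1}(N)=\sum_{t=i}^{k}\binom{a_t-1}{t}$, and $\delta_{k-1}(N)=\#\{t\in\{i,\ldots,k\}: a_t=t\}$; also set $\partial_{k-1}(0)=\partial^{k-1}(0)=\delta_{k-1}(0)=0$. (Binomial coefficients $\binom{p}{q}$ with $0\le p<q$ are $0$.) Thus for each integer $k\geq 0$, $\partial_k,\partial^k,\delta_k$ are functions on the nonnegative integers. -}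

module Defs where

open import Data.Nat using (ℕ; zero; suc; _+_; _∸_; _≤ᵇ_)
open import Data.Nat.Combinatorics using (_C_)
open import Data.Nat.Properties using (_≟_)
open import Data.Bool using (Bool; true; false; if_then_else_)
open import Data.List using (List; []; _∷_)
open import Data.Product using (_×_; _,_)
open import Relation.Nullary.Decidable using (does)

greatestBelow : (ℕ → Bool) → ℕ → ℕ
greatestBelow p zero    = 0
greatestBelow p (suc b) = if p (suc b) then suc b else greatestBelow p b

-- Largest a with (a choose t) ≤ N.  For t ≥ 1 such a satisfies a ≤ N + t - 1,
-- so searching up to N + t is exhaustive.
topCoeff : ℕ → ℕ → ℕ
topCoeff t N = greatestBelow (λ a → (a C t) ≤ᵇ N) (N + t)

-- macaulay t N : the t-binomial (greedy) expansion
--   N = C(a_t,t) + C(a_{t-1},t-1) + ... + C(a_i,i),  a_t > ... > a_i ≥ i ≥ 1,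
-- returned as the list of pairs (a_s , s), s = t, t-1, ..., i.
-- (Empty for N = 0.)
macaulay : ℕ → ℕ → List (ℕ × ℕ)
macaulay zero    N       = []
macaulay (suc t) zero    = []
macaulay (suc t) (suc M) =
  let a = topCoeff (suc t) (suc M) in
  (a , suc t) ∷ macaulay t (suc M ∸ (a C suc t))

-- ∂_k, ∂^k, δ_k use the (k+1)-binomial expansion ((k)-dimensional representation).
lowerSum : List (ℕ × ℕ) → ℕ
lowerSum []             = 0
lowerSum ((a , t) ∷ xs) = (a C (t ∸ 1)) + lowerSum xs

upperSum : List (ℕ × ℕ) → ℕ
upperSum []             = 0
upperSum ((a , t) ∷ xs) = ((a ∸ 1) C t) + upperSum xs

diagCount : List (ℕ × ℕ) → ℕ
diagCount []             = 0
diagCount ((a , t) ∷ xs) = (if does (a ≟ t) then 1 else 0) + diagCount xs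

shadow : ℕ → ℕ → ℕ
shadow k N = lowerSum (macaulay (suc k) N)

upperShadow : ℕ → ℕ → ℕ
upperShadow k N = upperSum (macaulay (suc k) N)

delta : ℕ → ℕ → ℕ
delta k N = diagCount (macaulay (suc k) N)

-- Write N = Σ C(a_s, s) for the (k+1)-binomial expansion.  By Pascal's rule the
-- map g(n) = n + ∂_k(n) sends the expansion Σ C(a_s, s) of n to Σ C(a_s + 1, s),
-- so g is strictly increasing, and ∂^k(N) = Σ C(a_s − 1, s) is the largest n with
-- g(n) ≤ N.  Moreover g(∂^k(N)) = N − δ_k(N): every term with a_s > s is
-- restored, while each diagonal term C(s, s) = 1 is lost.  With N = n + m the
-- three equivalences are formal consequences of these two facts.
module Submission where

open import Defs
open import Data.Nat using (ℕ; zero; suc; _+_; _∸_; _≤_; _<_; _≤ᵇ_; z≤n; s≤s)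
open import Data.Nat.Properties
open import Data.Nat.Combinatorics using (_C_; nCn≡1; nCk+nC[k+1]≡[n+1]C[k+1]; k>n⇒nCk≡0)
open import Algebra.Properties.CommutativeSemigroup +-commutativeSemigroup using (interchange)
open import Data.Bool using (true; false; T)
open import Data.Unit using (tt)
open import Data.Sum using (_⊎_; inj₁; inj₂)
open import Data.Product using (_×_; _,_; proj₁; proj₂)
open import Data.List using (_∷_)
open import Relation.Nullary using (contradiction; yes; no)
open import Relation.Nullary.Decidable using (dec-true; dec-false)
open import Relation.Binary.PropositionalEquality
open import Relation.Binary.Definitions using (tri<; tri≈; tri>)
open import Function.Bundles using (_⇔_; mk⇔)

C-pascal : ∀ a t → a C suc t + a C t ≡ suc a C suc t
C-pascal a t = trans (+-comm (a C suc t) (a C t)) (nCk+nC[k+1]≡[n+1]C[k+1] a t)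

C-≤-suc : ∀ a k → a C k ≤ suc a C k
C-≤-suc a zero    = ≤-refl
C-≤-suc a (suc t) = subst (a C suc t ≤_) (C-pascal a t) (m≤m+n (a C suc t) (a C t))

C-monoˡ-≤ : ∀ k {a b} → a ≤ b → a C k ≤ b C k
C-monoˡ-≤ k {a} {b} a≤b with m≤n⇒m<n∨m≡n a≤b
... | inj₂ refl = ≤-refl
C-monoˡ-≤ k {a} {suc b} _ | inj₁ (s≤s a≤b) = ≤-trans (C-monoˡ-≤ k a≤b) (C-≤-suc b k)

C-cancelˡ-< : ∀ k {a b} → a C k < b C k → a < b
C-cancelˡ-< k {a} {b} lt with a <? b
... | yes a<b = a<b
... | no a≮b  = contradiction (C-monoˡ-≤ k (≮⇒≥ a≮b)) (<⇒≱ lt)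

k≤n⇒0<nCk : ∀ {k a} → k ≤ a → 0 < a C k
k≤n⇒0<nCk {zero}              _         = s≤s z≤n
k≤n⇒0<nCk {suc t} {suc a} (s≤s t≤a) =
  ≤-trans (k≤n⇒0<nCk t≤a) (subst (a C t ≤_) (C-pascal a t) (m≤n+m (a C t) (a C suc t)))

[1+n]Cn≡1+n : ∀ t → suc t C t ≡ suc t
[1+n]Cn≡1+n zero    = refl
[1+n]Cn≡1+n (suc t) = begin
  suc (suc t) C suc t         ≡⟨ sym (C-pascal (suc t) t) ⟩
  suc t C suc t + suc t C t   ≡⟨ cong₂ _+_ (nCn≡1 (suc t)) ([1+n]Cn≡1+n t) ⟩
  suc (suc t)                 ∎
  where open ≡-Reasoning

1+d≤[1+t+d]C[1+t] : ∀ t d → suc d ≤ (suc t + d) C suc t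
1+d≤[1+t+d]C[1+t] t zero    rewrite +-identityʳ t | nCn≡1 (suc t) = ≤-refl
1+d≤[1+t+d]C[1+t] t (suc d) rewrite +-suc t d =
  subst (suc (suc d) ≤_) (nCk+nC[k+1]≡[n+1]C[k+1] (suc (t + d)) t)
    (+-mono-≤ (k≤n⇒0<nCk (≤-trans (m≤m+n t d) (n≤1+n _))) (1+d≤[1+t+d]C[1+t] t d))

C-bracket-unique : ∀ k {x a b} → a C k ≤ x → x < suc a C k → b C k ≤ x → x < suc b C k → a ≡ b
C-bracket-unique k {a = a} {b} a≤x x<a b≤x x<b with <-cmp a b
... | tri≈ _ a≡b _ = a≡b
... | tri< a<b _ _ = contradiction (≤-trans (C-monoˡ-≤ k a<b) b≤x) (<⇒≱ x<a)
... | tri> _ _ b<a = contradiction (≤-trans (C-monoˡ-≤ k b<a) a≤x) (<⇒≱ x<b)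

greatestBelow-≤ : ∀ p b → greatestBelow p b ≤ b
greatestBelow-≤ p zero    = ≤-refl
greatestBelow-≤ p (suc b) with p (suc b)
... | true  = ≤-refl
... | false = m≤n⇒m≤1+n (greatestBelow-≤ p b)

greatestBelow-sound : ∀ p b → p (greatestBelow p b) ≡ true ⊎ greatestBelow p b ≡ 0
greatestBelow-sound p zero    = inj₂ refl
greatestBelow-sound p (suc b) with p (suc b) in eq
... | true  = inj₁ eq
... | false = greatestBelow-sound p b

greatestBelow-maximal : ∀ p b {x} → greatestBelow p b < x → x ≤ b → p x ≡ false
greatestBelow-maximal p zero    gb<x x≤0 = contradiction (≤-trans x≤0 z≤n) (<⇒≱ gb<x)
greatestBelow-maximal p (suc b) {x} gb<x x≤b with p (suc b) in eq
... | true  = contradiction x≤b (<⇒≱ gb<x)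
... | false with m≤n⇒m<n∨m≡n x≤b
...   | inj₁ (s≤s x≤b′) = greatestBelow-maximal p b gb<x x≤b′
...   | inj₂ refl       = eq

topCoeff-C-≤ : ∀ t N → topCoeff (suc t) N C suc t ≤ N
topCoeff-C-≤ t N with greatestBelow-sound (λ a → a C suc t ≤ᵇ N) (N + suc t)
... | inj₁ found = ≤ᵇ⇒≤ _ N (subst T (sym found) tt)
... | inj₂ none  = subst (λ a → a C suc t ≤ N) (sym none) z≤n

<topCoeff-C : ∀ t N → N < suc (topCoeff (suc t) N) C suc t
<topCoeff-C t N with suc (topCoeff (suc t) N) ≤? N + suc t
... | yes a<bound = ≰⇒> λ le →
  subst T (greatestBelow-maximal (λ a → a C suc t ≤ᵇ N) (N + suc t) ≤-refl a<bound) (≤⇒≤ᵇ le)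
... | no a≮bound = subst (λ a → N < suc a C suc t) (sym a≡bound)
  (≤-trans (subst (λ b → N < b C suc t) (+-comm (suc t) N) (1+d≤[1+t+d]C[1+t] t N))
           (C-≤-suc (N + suc t) (suc t)))
  where
  a≡bound : topCoeff (suc t) N ≡ N + suc t
  a≡bound = ≤-antisym (greatestBelow-≤ _ (N + suc t)) (≤-pred (≰⇒> a≮bound))

-- One greedy step N = C(top, t + 1) + rest; the bound on rest forces the terms
-- of its t-binomial expansion to lie below top.
record LeadingTerm (t N : ℕ) : Set where
  field
    top rest : ℕ
    t<top    : t < top
    split    : N ≡ top C suc t + rest
    rest<    : rest < top C t

module _ {t N : ℕ} (L : LeadingTerm t N) where
  open LeadingTerm L

  leadingTerm-bounds : top C suc t ≤ N × N < suc top C suc t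
  leadingTerm-bounds =
    subst (top C suc t ≤_) (sym split) (m≤m+n _ rest) ,
    subst₂ _<_ (sym split) (C-pascal top t) (+-monoʳ-< (top C suc t) rest<)

  leadingTerm-pos : 0 < N
  leadingTerm-pos = ≤-trans (k≤n⇒0<nCk t<top) (proj₁ leadingTerm-bounds)

  t≡0⇒rest≡0 : t ≡ 0 → rest ≡ 0
  t≡0⇒rest≡0 refl = n<1⇒n≡0 rest<

macaulay-leading : ∀ {t N} (L : LeadingTerm t N) →
                   macaulay (suc t) N ≡ (LeadingTerm.top L , suc t) ∷ macaulay t (LeadingTerm.rest L)
macaulay-leading {N = zero}  L = contradiction (leadingTerm-pos L) (λ ())
macaulay-leading {t} {suc M} L = cong₂ (λ a r → (a , suc t) ∷ macaulay t r) top≡ rest≡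
  where
  open LeadingTerm L
  top≡ : topCoeff (suc t) (suc M) ≡ top
  top≡ = C-bracket-unique (suc t) (topCoeff-C-≤ t (suc M)) (<topCoeff-C t (suc M))
           (proj₁ (leadingTerm-bounds L)) (proj₂ (leadingTerm-bounds L))
  rest≡ : suc M ∸ topCoeff (suc t) (suc M) C suc t ≡ rest
  rest≡ = begin
    suc M ∸ topCoeff (suc t) (suc M) C suc t ≡⟨ cong₂ (λ n a → n ∸ a C suc t) split top≡ ⟩
    top C suc t + rest ∸ top C suc t         ≡⟨ m+n∸m≡n (top C suc t) rest ⟩
    rest                                     ∎
    where open ≡-Reasoning

greedyLeadingTerm : ∀ t M → LeadingTerm t (suc M)
greedyLeadingTerm t M = record
  { top   = a
  ; rest  = suc M ∸ a C suc t
  ; t<top = t<a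
  ; split = sym (m+[n∸m]≡n (topCoeff-C-≤ t (suc M)))
  ; rest< = +-cancelˡ-< (a C suc t) _ _
      (subst₂ _<_ (sym (m+[n∸m]≡n (topCoeff-C-≤ t (suc M)))) (sym (C-pascal a t)) (<topCoeff-C t (suc M)))
  }
  where
  a = topCoeff (suc t) (suc M)
  t<a : t < a
  t<a with t <? a
  ... | yes t<a = t<a
  ... | no t≮a with ≤-trans (<topCoeff-C t (suc M))
                    (≤-trans (C-monoˡ-≤ (suc t) (s≤s (≮⇒≥ t≮a))) (≤-reflexive (nCn≡1 (suc t))))
  ...   | s≤s ()

-- Indexed by the order j = k + 1 of the expansion, so that shadow k = ∂ (suc k).
∂ ∂ᵘ δ : ℕ → ℕ → ℕ
∂  j n = lowerSum (macaulay j n)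
∂ᵘ j n = upperSum (macaulay j n)
δ  j n = diagCount (macaulay j n)

plusShadow : ℕ → ℕ → ℕ
plusShadow j n = n + ∂ j n

module _ {t N : ℕ} (L : LeadingTerm t N) where
  open LeadingTerm L

  plusShadow-leading : plusShadow (suc t) N ≡ suc top C suc t + plusShadow t rest
  plusShadow-leading = begin
    N + ∂ (suc t) N                             ≡⟨ cong₂ _+_ split (cong lowerSum (macaulay-leading L)) ⟩
    (top C suc t + rest) + (top C t + ∂ t rest) ≡⟨ interchange (top C suc t) rest (top C t) (∂ t rest) ⟩
    (top C suc t + top C t) + plusShadow t rest ≡⟨ cong (_+ plusShadow t rest) (C-pascal top t) ⟩
    suc top C suc t + plusShadow t rest         ∎
    where open ≡-Reasoning

  ∂ᵘ-leading : ∂ᵘ (suc t) N ≡ (top ∸ 1) C suc t + ∂ᵘ t rest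
  ∂ᵘ-leading = cong upperSum (macaulay-leading L)

  δ-leading-diagonal : top ≡ suc t → δ (suc t) N ≡ suc (δ t rest)
  δ-leading-diagonal top≡ rewrite macaulay-leading L | dec-true (top ≟ suc t) top≡ = refl

  δ-leading-offDiagonal : suc t < top → δ (suc t) N ≡ δ t rest
  δ-leading-offDiagonal t<top rewrite macaulay-leading L | dec-false (top ≟ suc t) (>⇒≢ t<top) = refl

  plusShadow-≥-leading : suc top C suc t ≤ plusShadow (suc t) N
  plusShadow-≥-leading = subst (suc top C suc t ≤_) (sym plusShadow-leading) (m≤m+n _ _)

plusShadow-<-bound : ∀ j {a n} → n < a C j → plusShadow j n < suc a C j
plusShadow-<-bound zero    {n = zero}  _        = s≤s z≤n
plusShadow-<-bound zero    {n = suc n} (s≤s ())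
plusShadow-<-bound (suc t) {a} {zero}  0<aCj    = ≤-trans 0<aCj (C-≤-suc a (suc t))
plusShadow-<-bound (suc t) {a} {suc M} n<aCj    = begin-strict
  plusShadow (suc t) (suc M)          ≡⟨ plusShadow-leading L ⟩
  suc b C suc t + plusShadow t r      <⟨ +-monoʳ-< (suc b C suc t) (plusShadow-<-bound t rest<) ⟩
  suc b C suc t + suc b C t           ≡⟨ C-pascal (suc b) t ⟩
  suc (suc b) C suc t                 ≤⟨ C-monoˡ-≤ (suc t) (s≤s b<a) ⟩
  suc a C suc t                       ∎
  where
  open ≤-Reasoning
  L = greedyLeadingTerm t M
  open LeadingTerm L renaming (top to b; rest to r)
  b<a : b < a
  b<a = C-cancelˡ-< (suc t) (≤-<-trans (proj₁ (leadingTerm-bounds L)) n<aCj)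

plusShadow-strictMono : ∀ j {n n′} → n < n′ → plusShadow j n < plusShadow j n′
plusShadow-strictMono zero    n<n′ = +-monoˡ-< 0 n<n′
plusShadow-strictMono (suc t) {zero} {n′} 0<n′ = ≤-trans 0<n′ (m≤m+n n′ _)
plusShadow-strictMono (suc t) {suc M} {suc M′} n<n′ =
  compareLeading (greedyLeadingTerm t M) (greedyLeadingTerm t M′)
  where
  open ≤-Reasoning
  compareLeading : LeadingTerm t (suc M) → LeadingTerm t (suc M′) →
                   plusShadow (suc t) (suc M) < plusShadow (suc t) (suc M′)
  compareLeading L@record { top = a ; rest = r ; split = split }
                 L′@record { top = a′ ; rest = r′ ; split = split′ } with <-cmp a a′
  ... | tri< a<a′ _ _ = begin-strict
    plusShadow (suc t) (suc M)   <⟨ plusShadow-<-bound (suc t) (proj₂ (leadingTerm-bounds L)) ⟩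
    suc (suc a) C suc t          ≤⟨ C-monoˡ-≤ (suc t) (s≤s a<a′) ⟩
    suc a′ C suc t               ≤⟨ plusShadow-≥-leading L′ ⟩
    plusShadow (suc t) (suc M′)  ∎
  ... | tri≈ _ refl _ = begin-strict
    plusShadow (suc t) (suc M)       ≡⟨ plusShadow-leading L ⟩
    suc a C suc t + plusShadow t r   <⟨ +-monoʳ-< (suc a C suc t) (plusShadow-strictMono t r<r′) ⟩
    suc a C suc t + plusShadow t r′  ≡⟨ plusShadow-leading L′ ⟨
    plusShadow (suc t) (suc M′)      ∎
    where
    r<r′ : r < r′
    r<r′ = +-cancelˡ-< (a C suc t) _ _ (subst₂ _<_ split split′ n<n′)
  ... | tri> _ _ a′<a = contradiction (proj₁ (leadingTerm-bounds L))
    (<⇒≱ (≤-trans (<-trans n<n′ (proj₂ (leadingTerm-bounds L′))) (C-monoˡ-≤ (suc t) a′<a)))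

plusShadow-mono : ∀ j {n n′} → n ≤ n′ → plusShadow j n ≤ plusShadow j n′
plusShadow-mono j n≤n′ with m≤n⇒m<n∨m≡n n≤n′
... | inj₁ n<n′ = <⇒≤ (plusShadow-strictMono j n<n′)
... | inj₂ refl = ≤-refl

plusShadow-injective : ∀ j {n n′} → plusShadow j n ≡ plusShadow j n′ → n ≡ n′
plusShadow-injective j {n} {n′} eq with <-cmp n n′
... | tri< n<n′ _ _ = contradiction eq (<⇒≢ (plusShadow-strictMono j n<n′))
... | tri≈ _ n≡n′ _ = n≡n′
... | tri> _ _ n′<n = contradiction (sym eq) (<⇒≢ (plusShadow-strictMono j n′<n))

∂ᵘ-<-bound : ∀ j {a n} → j ≤ a → n < suc a C j → ∂ᵘ j n < a C j
∂ᵘ-<-bound zero    {n = zero}  _   _        = s≤s z≤n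
∂ᵘ-<-bound zero    {n = suc n} _   (s≤s ())
∂ᵘ-<-bound (suc t) {n = zero}  j≤a _        = k≤n⇒0<nCk j≤a
∂ᵘ-<-bound (suc t) {a} {suc M} _   n<1+aCj  = bound (greedyLeadingTerm t M)
  where
  open ≤-Reasoning
  bound : LeadingTerm t (suc M) → ∂ᵘ (suc t) (suc M) < a C suc t
  bound L@record { top = suc b ; rest = r ; t<top = s≤s t≤b ; rest< = rest< } = begin-strict
    ∂ᵘ (suc t) (suc M)    ≡⟨ ∂ᵘ-leading L ⟩
    b C suc t + ∂ᵘ t r    <⟨ +-monoʳ-< (b C suc t) (∂ᵘ-<-bound t t≤b rest<) ⟩
    b C suc t + b C t     ≡⟨ C-pascal b t ⟩
    suc b C suc t         ≤⟨ C-monoˡ-≤ (suc t) (≤-pred b<a) ⟩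
    a C suc t             ∎
    where
    b<a : suc b < suc a
    b<a = C-cancelˡ-< (suc t) (≤-<-trans (proj₁ (leadingTerm-bounds L)) n<1+aCj)

-- For R ≤ j the expansion is C(j, j) + C(j−1, j−1) + ⋯ + C(j−R+1, j−R+1).
diagonalExpansion : ∀ j {R} → R ≤ j → ∂ᵘ j R ≡ 0 × δ j R ≡ R
diagonalExpansion zero    {zero}  _          = refl , refl
diagonalExpansion (suc t) {zero}  _          = refl , refl
diagonalExpansion (suc t) {suc M} (s≤s M≤t) =
  trans (∂ᵘ-leading L) (cong₂ _+_ (k>n⇒nCk≡0 (n<1+n t)) (proj₁ ih)) ,
  trans (δ-leading-diagonal L refl) (cong suc (proj₂ ih))
  where
  ih = diagonalExpansion t M≤t
  L : LeadingTerm t (suc M)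
  L = record
    { top   = suc t
    ; rest  = M
    ; t<top = ≤-refl
    ; split = cong (_+ M) (sym (nCn≡1 (suc t)))
    ; rest< = subst (M <_) (sym ([1+n]Cn≡1+n t)) (s≤s M≤t)
    }

-- The hypothesis only excludes j = 0, where no N > 0 has an expansion.
plusShadow-∂ᵘ-+-δ : ∀ j {N} → (j ≡ 0 → N ≡ 0) → plusShadow j (∂ᵘ j N) + δ j N ≡ N
plusShadow-∂ᵘ-+-δ zero    expandable = sym (expandable refl)
plusShadow-∂ᵘ-+-δ (suc t) {zero}  _  = refl
plusShadow-∂ᵘ-+-δ (suc t) {suc M} _  = fromLeading (greedyLeadingTerm t M)
  where
  open ≡-Reasoning
  fromLeading : LeadingTerm t (suc M) → plusShadow (suc t) (∂ᵘ (suc t) (suc M)) + δ (suc t) (suc M) ≡ suc M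
  fromLeading L@record { top = top ; rest = r ; t<top = t<top ; split = split ; rest< = rest< }
    with m≤n⇒m<n∨m≡n t<top
  ... | inj₂ refl = cong₂ (λ u d → plusShadow (suc t) u + d) (proj₁ diagonal) (proj₂ diagonal)
    where
    diagonal = diagonalExpansion (suc t)
      (≤-pred (subst (suc M <_) ([1+n]Cn≡1+n (suc t)) (proj₂ (leadingTerm-bounds L))))
  ... | inj₁ (s≤s {n = b} t<b) = begin
    plusShadow (suc t) (∂ᵘ (suc t) (suc M)) + δ (suc t) (suc M)
      ≡⟨ cong₂ (λ u d → plusShadow (suc t) u + d) (∂ᵘ-leading L) (δ-leading-offDiagonal L (s≤s t<b)) ⟩
    plusShadow (suc t) (b C suc t + ∂ᵘ t r) + δ t r
      ≡⟨ cong (_+ δ t r) (plusShadow-leading L′) ⟩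
    (suc b C suc t + plusShadow t (∂ᵘ t r)) + δ t r
      ≡⟨ +-assoc (suc b C suc t) _ _ ⟩
    suc b C suc t + (plusShadow t (∂ᵘ t r) + δ t r)
      ≡⟨ cong (suc b C suc t +_) (plusShadow-∂ᵘ-+-δ t (t≡0⇒rest≡0 L)) ⟩
    suc b C suc t + r
      ≡⟨ sym split ⟩
    suc M ∎
    where
    L′ : LeadingTerm t (b C suc t + ∂ᵘ t r)
    L′ = record
      { top = b ; rest = ∂ᵘ t r ; t<top = t<b ; split = refl ; rest< = ∂ᵘ-<-bound t (<⇒≤ t<b) rest< }

plusShadow≤⇒≤∂ᵘ : ∀ j {n N} → (j ≡ 0 → N ≡ 0) → plusShadow j n ≤ N → n ≤ ∂ᵘ j N
plusShadow≤⇒≤∂ᵘ zero    {n} expandable le = ≤-trans (m≤m+n n 0) (subst (n + 0 ≤_) (expandable refl) le)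
plusShadow≤⇒≤∂ᵘ (suc t) {zero}          _ _  = z≤n
plusShadow≤⇒≤∂ᵘ (suc t) {suc M} {zero}  _ le = contradiction (≤-trans (m≤m+n (suc M) _) le) λ ()
plusShadow≤⇒≤∂ᵘ (suc t) {suc M} {suc M′} _ le = compare (greedyLeadingTerm t M) (greedyLeadingTerm t M′)
  where
  open ≤-Reasoning
  compare : LeadingTerm t (suc M) → LeadingTerm t (suc M′) → suc M ≤ ∂ᵘ (suc t) (suc M′)
  compare L@record { top = b ; rest = r ; split = split }
          L′@record { top = suc a ; rest = R ; split = split′ }
    with m≤n⇒m<n∨m≡n b≤a
    where
    b≤a : b ≤ a
    b≤a = ≤-pred (≤-pred (C-cancelˡ-< (suc t)
      (≤-<-trans (≤-trans (plusShadow-≥-leading L) le) (proj₂ (leadingTerm-bounds L′)))))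
  ... | inj₁ b<a = begin
    suc M                     <⟨ proj₂ (leadingTerm-bounds L) ⟩
    suc b C suc t             ≤⟨ C-monoˡ-≤ (suc t) b<a ⟩
    a C suc t                 ≤⟨ m≤m+n _ _ ⟩
    a C suc t + ∂ᵘ t R        ≡⟨ ∂ᵘ-leading L′ ⟨
    ∂ᵘ (suc t) (suc M′)       ∎
  ... | inj₂ refl = begin
    suc M                     ≡⟨ split ⟩
    b C suc t + r             ≤⟨ +-monoʳ-≤ (b C suc t) (plusShadow≤⇒≤∂ᵘ t (t≡0⇒rest≡0 L′) shadow≤) ⟩
    b C suc t + ∂ᵘ t R        ≡⟨ ∂ᵘ-leading L′ ⟨
    ∂ᵘ (suc t) (suc M′)       ∎
    where
    shadow≤ : plusShadow t r ≤ R
    shadow≤ = +-cancelˡ-≤ (suc b C suc t) _ _ (subst₂ _≤_ (plusShadow-leading L) split′ le)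

≤∂ᵘ⇒plusShadow+δ≤ : ∀ j {n N} → (j ≡ 0 → N ≡ 0) → n ≤ ∂ᵘ j N → plusShadow j n + δ j N ≤ N
≤∂ᵘ⇒plusShadow+δ≤ j expandable n≤∂ᵘN =
  ≤-trans (+-monoˡ-≤ _ (plusShadow-mono j n≤∂ᵘN)) (≤-reflexive (plusShadow-∂ᵘ-+-δ j expandable))

theorem1p3 : (k n m ε : ℕ) → ε ≤ delta k (n + m) →
    ((shadow k n + ε ≤ m) ⇔ (n ≤ upperShadow k (n + m)))
    × ((n ≡ upperShadow k (n + m)) ⇔ (shadow k n + delta k (n + m) ≡ m))
    × ((shadow k n ≡ m) ⇔ ((n ≡ upperShadow k (n + m)) × (delta k (n + m) ≡ 0)))
theorem1p3 k n m ε ε≤δ =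
  mk⇔ (λ ∂n+ε≤m → galois (+-monoʳ-≤ n (≤-trans (m≤m+n ∂n ε) ∂n+ε≤m)))
      (λ n≤u → ≤-trans (+-monoʳ-≤ ∂n ε≤δ) (≤u⇒∂+δ≤ n≤u)) ,
  mk⇔ ≡u⇒∂+δ≡ ∂+δ≡⇒≡u ,
  mk⇔ (λ ∂n≡m → ∂+δ≡⇒≡u (trans (cong (∂n +_) (δ≡0 ∂n≡m)) (trans (+-identityʳ ∂n) ∂n≡m)) , δ≡0 ∂n≡m)
      (λ { (n≡u , d≡0) → trans (sym (+-identityʳ ∂n)) (trans (cong (∂n +_) (sym d≡0)) (≡u⇒∂+δ≡ n≡u)) })
  where
  j  = suc k
  ∂n = shadow k n
  u  = upperShadow k (n + m)
  d  = delta k (n + m)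
  restore : plusShadow j u + d ≡ n + m
  restore = plusShadow-∂ᵘ-+-δ j λ ()
  galois : plusShadow j n ≤ n + m → n ≤ u
  galois = plusShadow≤⇒≤∂ᵘ j λ ()
  ≤u⇒∂+δ≤ : n ≤ u → ∂n + d ≤ m
  ≤u⇒∂+δ≤ n≤u = +-cancelˡ-≤ n _ _ (subst (_≤ n + m) (+-assoc n ∂n d) (≤∂ᵘ⇒plusShadow+δ≤ j (λ ()) n≤u))
  ≡u⇒∂+δ≡ : n ≡ u → ∂n + d ≡ m
  ≡u⇒∂+δ≡ n≡u = +-cancelˡ-≡ n _ _
    (trans (sym (+-assoc n ∂n d)) (trans (cong (λ x → plusShadow j x + d) n≡u) restore))
  ∂+δ≡⇒≡u : ∂n + d ≡ m → n ≡ u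
  ∂+δ≡⇒≡u eq = plusShadow-injective j
    (+-cancelʳ-≡ d _ _ (trans (+-assoc n ∂n d) (trans (cong (n +_) eq) (sym restore))))
  δ≡0 : ∂n ≡ m → d ≡ 0
  δ≡0 ∂n≡m = n≤0⇒n≡0 (+-cancelˡ-≤ ∂n d 0
    (subst (∂n + d ≤_) (trans (sym ∂n≡m) (sym (+-identityʳ ∂n))) (≤u⇒∂+δ≤ (galois (≤-reflexive (cong (n +_) ∂n≡m))))))
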